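{- Let $a,c,d,n$ be positive integers with $ac$ odd and $d\equiv 2\pmod 4$ or $d\equiv c\pmod 4$. Then $$t(a,3a,c,d;n)=2N(4a,12a,c,d;8n+4a+c+d).$$
   Context: For positive integers $a_1,\dots,a_k$ and a nonnegative integer $n$, $N(a_1,\dots,a_k;n)$ is the number of $(x_1,\dots,x_k)\in\mathbb Z^k$ with $n=a_1x_1^2+\cdots+a_kx_k^2$, and $t(a_1,\dots,a_k;n)$ is the number of $(x_1,\dots,x_k)\in\mathbb Z^k$ with $n=a_1\frac{x_1(x_1-1)}2+\cdots+a_k\frac{x_k(x_k-1)}2$. -}

module Defs where

open import Data.Nat using (ℕ; zero; suc; _+_; _*_; _/_; _≟_)
open import Data.Integer using (ℤ; +_; ∣_∣) renaming (_*_ to _*ℤ_; _-_ to _-ℤ_)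
open import Data.List using (List; []; _∷_; map; upTo; concatMap; filter; length; zipWith)
open import Data.Nat.ListAction using (sum)

box : ℕ → List ℤ
box B = map (λ i → (+ i) -ℤ (+ B)) (upTo (suc (B + B)))

tuples : ℕ → List ℤ → List (List ℤ)
tuples zero    xs = [] ∷ []
tuples (suc k) xs = concatMap (λ x → map (x ∷_) (tuples k xs)) xs

form : (ℤ → ℕ) → List ℕ → List ℤ → ℕ
form f as xs = sum (zipWith (λ a x → a * f x) as xs)

sq : ℤ → ℕ
sq x = ∣ x *ℤ x ∣

-- x(x-1)/2  (x(x-1) ≥ 0 for every integer x, so the absolute value is harmless)
tri : ℤ → ℕ
tri x = ∣ x *ℤ (x -ℤ + 1) ∣ / 2

-- N(a₁,…,a_k; n): number of (x₁,…,x_k) ∈ ℤ^k with n = Σ aᵢ xᵢ².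
-- For positive aᵢ every solution has |xᵢ| ≤ n, so counting over the box [-n,n]^k is exact.
N : List ℕ → ℕ → ℕ
N as n = length (filter (λ xs → form sq as xs ≟ n) (tuples (length as) (box n)))

-- t(a₁,…,a_k; n): number of (x₁,…,x_k) ∈ ℤ^k with n = Σ aᵢ xᵢ(xᵢ-1)/2.
-- For positive aᵢ every solution has |xᵢ| ≤ n+1, so counting over [-(n+1),n+1]^k is exact.
t : List ℕ → ℕ → ℕ
t as n = length (filter (λ xs → form tri as xs ≟ n) (tuples (length as) (box (suc n))))

module Submission where

-- Since 8 tri x + 1 = (2x - 1)², a solution x of the triangular equation gives
--   8n + 4a + c + d = a(2x₁ - 1)² + 3a(2x₂ - 1)² + c(2x₃ - 1)² + d(2x₄ - 1)².
-- If x₁ - x₂ = 2v is even, put s = 2x₂ - 1; the identity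
--   (s + 4v)² + 3s² = 4((s + v)² + 3v²)
-- turns this into a solution (s + v, v, 2x₃ - 1, 2x₄ - 1) of
-- 4a u² + 12a v² + c z² + d w² = 8n + 4a + c + d.  Conversely, the congruence
-- conditions on a, c, d force z, w and u - v to be odd in every solution of the
-- quadratic equation (look at it mod 4, then mod 8), so the correspondence is a
-- bijection.  The reflection x₂ ↦ 1 - x₂ preserves tri and changes the parity of
-- x₁ - x₂, which doubles the count.

open import Defs
open import Data.Empty using (⊥-elim)
open import Data.Integer using (ℤ; +_; -[1+_]; +[1+_]; ∣_∣)
  renaming (_+_ to _+ℤ_; _*_ to _*ℤ_; _-_ to _-ℤ_; -_ to -ℤ_)
import Data.Integer.Properties as ℤ
open import Algebra.Properties.AbelianGroup ℤ.+-0-abelianGroup using (∙-cancelʳ)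
open import Data.Integer.DivMod using (_%ℕ_; _/ℕ_; a≡a%ℕn+[a/ℕn]*n; n%ℕd<d)
open import Data.Integer.Divisibility.Signed
  using (_∣_; divides; _∣?_; ∣m+n∣m⇒∣n; ∣m∣n⇒∣m-n; ∣⇒∣ᵤ)
import Data.Integer.Tactic.RingSolver as ℤ-Solver
open import Data.List
  using (List; []; _∷_; _++_; map; concatMap; cartesianProductWith; length; filter)
open import Data.List.Properties using (length-++-sucʳ; ∷-injective)
open import Data.List.Membership.Propositional using (_∈_)
open import Data.List.Membership.Propositional.Properties
  using (∈-∃++; ∈-++⁻; ∈-++⁺ˡ; ∈-++⁺ʳ; ∈-filter⁻; ∈-filter⁺; ∈-map⁺; ∈-upTo⁺;
         ∈-cartesianProductWith⁺; ∈-cartesianProductWith⁻)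
open import Data.List.Relation.Unary.All as All using (All)
open import Data.List.Relation.Unary.Any using (here; there)
import Data.List.Relation.Unary.AllPairs as AllPairs
open import Data.List.Relation.Unary.Unique.Propositional using (Unique)
import Data.List.Relation.Unary.Unique.Propositional.Properties as Unique
open import Data.Nat
  using (ℕ; zero; suc; _+_; _*_; _∸_; _/_; _%_; _≤_; _<_; _≟_; z≤n; s≤s; NonZero)
open import Data.Nat.Properties
  using (≤-antisym; ≤-trans; +-suc; +-identityʳ; suc-injective; 0≢1+n; *-comm; *-assoc;
         *-distribˡ-+; m≤m+n; m≤n+m; m≤m*n; m≤n*m; m≤n⇒m≤1+n; m∸n≤m; m∸n+n≡m;
         +-monoˡ-≤; +-cancelˡ-≡; +-cancelʳ-≡; *-cancelˡ-≡; m*n≢0)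
open import Data.Nat.DivMod
  using (m≡m%n+[m/n]*n; [m+kn]%n≡m%n; %-distribˡ-+; %-distribˡ-*; m%n<n; m*n%n≡0;
         m*n/n≡m; m∣n⇒o%n%m≡o%m)
open import Data.Nat.Divisibility using (∣1⇒≡1)
import Data.Nat.Divisibility.Core as ℕᵈ
open import Data.Nat.ListAction using (sum)
import Data.Nat.Tactic.RingSolver as ℕ-Solver
open import Data.Product using (∃-syntax; _×_; _,_; proj₁; proj₂)
open import Data.Sum using (_⊎_; inj₁; inj₂)
open import Function using (flip)
open import Relation.Nullary using (¬_; yes; no)
open import Relation.Unary using (Decidable)
open import Relation.Unary.Properties using (_∩?_; ∁?)
open import Relation.Binary.PropositionalEquality
  using (_≡_; _≢_; refl; sym; trans; cong; cong₂; subst; subst₂; module ≡-Reasoning)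
open ≡-Reasoning

-- Counting through a bijective relation

module _ {A B : Set} (_~_ : A → B → Set) where

  length-≤-by-injection : ∀ {xs ys} → Unique xs →
    (∀ {x} → x ∈ xs → ∃[ y ] y ∈ ys × x ~ y) →
    (∀ {x x′ y} → x ~ y → x′ ~ y → x ≡ x′) →
    length xs ≤ length ys
  length-≤-by-injection {[]}     _            _     _         = z≤n
  -- Remove the partner y of x from ys; by injectivity no other element of xs needs it.
  length-≤-by-injection {x ∷ xs} (x∉xs AllPairs.∷ xs!) related injective
    with y , y∈ys , x~y ← related (here refl)
    with ys₁ , ys₂ , refl ← ∈-∃++ y∈ys =
      subst (suc (length xs) ≤_) (sym (length-++-sucʳ ys₁ y ys₂))
        (s≤s (length-≤-by-injection xs! related′ injective))
    where
    related′ : ∀ {x′} → x′ ∈ xs → ∃[ y′ ] y′ ∈ ys₁ ++ ys₂ × x′ ~ y′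
    related′ x′∈xs with y′ , y′∈ys , x′~y′ ← related (there x′∈xs) with ∈-++⁻ ys₁ y′∈ys
    ... | inj₁ y′∈ys₁         = y′ , ∈-++⁺ˡ y′∈ys₁ , x′~y′
    ... | inj₂ (here refl)    = ⊥-elim (All.lookup x∉xs x′∈xs (injective x~y x′~y′))
    ... | inj₂ (there y′∈ys₂) = y′ , ∈-++⁺ʳ ys₁ y′∈ys₂ , x′~y′

module _ {A B : Set} {P : A → Set} {Q : B → Set} (P? : Decidable P) (Q? : Decidable Q)
         (_~_ : A → B → Set) where

  length-filter-≡ : ∀ {xs ys} → Unique xs → Unique ys →
    (∀ {x} → x ∈ xs → P x → ∃[ y ] y ∈ ys × Q y × x ~ y) →
    (∀ {y} → y ∈ ys → Q y → ∃[ x ] x ∈ xs × P x × x ~ y) →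
    (∀ {x x′ y} → x ~ y → x′ ~ y → x ≡ x′) →
    (∀ {x y y′} → x ~ y → x ~ y′ → y ≡ y′) →
    length (filter P? xs) ≡ length (filter Q? ys)
  length-filter-≡ {xs} {ys} xs! ys! forth back injective functional = ≤-antisym
    (length-≤-by-injection _~_ (Unique.filter⁺ P? xs!) forth′ injective)
    (length-≤-by-injection (flip _~_) (Unique.filter⁺ Q? ys!) back′ functional)
    where
    forth′ : ∀ {x} → x ∈ filter P? xs → ∃[ y ] y ∈ filter Q? ys × x ~ y
    forth′ x∈ with x∈xs , Px ← ∈-filter⁻ P? x∈ with y , y∈ys , Qy , x~y ← forth x∈xs Px =
      y , ∈-filter⁺ Q? y∈ys Qy , x~y
    back′ : ∀ {y} → y ∈ filter Q? ys → ∃[ x ] x ∈ filter P? xs × x ~ y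
    back′ y∈ with y∈ys , Qy ← ∈-filter⁻ Q? y∈ with x , x∈xs , Px , x~y ← back y∈ys Qy =
      x , ∈-filter⁺ P? x∈xs Px , x~y

length-filter-split : ∀ {A : Set} {P R : A → Set} (P? : Decidable P) (R? : Decidable R) xs →
  length (filter P? xs) ≡ length (filter (P? ∩? R?) xs) + length (filter (P? ∩? ∁? R?) xs)
length-filter-split P? R? []       = refl
length-filter-split P? R? (x ∷ xs) with P? x | R? x
... | yes _ | yes _ = cong suc (length-filter-split P? R? xs)
... | yes _ | no _  = trans (cong suc (length-filter-split P? R? xs)) (sym (+-suc _ _))
... | no _  | _     = length-filter-split P? R? xs

concatMap-∷≡cartesianProductWith : ∀ {A : Set} (xs : List A) (yss : List (List A)) →
  concatMap (λ x → map (x ∷_) yss) xs ≡ cartesianProductWith _∷_ xs yss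
concatMap-∷≡cartesianProductWith []       yss = refl
concatMap-∷≡cartesianProductWith (x ∷ xs) yss =
  cong (map (x ∷_) yss ++_) (concatMap-∷≡cartesianProductWith xs yss)

tuples-suc : ∀ k xs → tuples (suc k) xs ≡ cartesianProductWith _∷_ xs (tuples k xs)
tuples-suc k xs = concatMap-∷≡cartesianProductWith xs (tuples k xs)

tuples-unique : ∀ k {xs} → Unique xs → Unique (tuples k xs)
tuples-unique zero         _   = All.[] AllPairs.∷ AllPairs.[]
tuples-unique (suc k) {xs} xs! = subst Unique (sym (tuples-suc k xs))
  (Unique.cartesianProductWith⁺ _∷_ ∷-injective xs! (tuples-unique k xs!))

∈-tuples⁺ : ∀ {xs ys} → All (_∈ ys) xs → xs ∈ tuples (length xs) ys
∈-tuples⁺                       All.[]              = here refl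
∈-tuples⁺ {x ∷ xs} {ys} (x∈ys All.∷ xs⊆ys) = subst (x ∷ xs ∈_) (sym (tuples-suc (length xs) ys))
  (∈-cartesianProductWith⁺ _∷_ x∈ys (∈-tuples⁺ xs⊆ys))

∈-tuples⇒length : ∀ k {xs ys} → xs ∈ tuples k ys → length xs ≡ k
∈-tuples⇒length zero    (here refl) = refl
∈-tuples⇒length zero    (there ())
∈-tuples⇒length (suc k) {ys = ys} xs∈
  with _ , _ , _ , xs′∈ , refl ← ∈-cartesianProductWith⁻ _∷_ ys (tuples k ys)
                                   (subst (_ ∈_) (tuples-suc k ys) xs∈) =
    cong suc (∈-tuples⇒length k {ys = ys} xs′∈)

data Quad {A : Set} : List A → Set where
  quad : ∀ x₁ x₂ x₃ x₄ → Quad (x₁ ∷ x₂ ∷ x₃ ∷ x₄ ∷ [])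

length≡4⇒Quad : ∀ {A : Set} (xs : List A) → length xs ≡ 4 → Quad xs
length≡4⇒Quad (_ ∷ _ ∷ _ ∷ _ ∷ [])    _  = quad _ _ _ _
length≡4⇒Quad []                     ()
length≡4⇒Quad (_ ∷ [])               ()
length≡4⇒Quad (_ ∷ _ ∷ [])           ()
length≡4⇒Quad (_ ∷ _ ∷ _ ∷ [])       ()
length≡4⇒Quad (_ ∷ _ ∷ _ ∷ _ ∷ _ ∷ _) ()

i+j-j≡i : ∀ i j → i +ℤ j -ℤ j ≡ i
i+j-j≡i = ℤ-Solver.solve-∀

i-j≡k⇒i≡k+j : ∀ i j {k} → i -ℤ j ≡ k → i ≡ k +ℤ j
i-j≡k⇒i≡k+j i j refl = ℤ-Solver.solve (i ∷ j ∷ [])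

box-unique : ∀ B → Unique (box B)
box-unique B = Unique.map⁺ (λ eq → ℤ.+-injective (∙-cancelʳ (-ℤ + B) _ _ eq)) (Unique.upTo⁺ _)

∈-box⁺ : ∀ {B} x → ∣ x ∣ ≤ B → x ∈ box B
∈-box⁺ {B} (+ k) k≤B =
  subst (_∈ box B) shift (∈-map⁺ _ (∈-upTo⁺ (s≤s (+-monoˡ-≤ B k≤B))))
  where
  shift : + (k + B) -ℤ + B ≡ + k
  shift = trans (cong (_-ℤ + B) (ℤ.pos-+ k B)) (i+j-j≡i (+ k) (+ B))
∈-box⁺ {B} -[1+ k ] k<B =
  subst (_∈ box B) shift (∈-map⁺ _ (∈-upTo⁺ (s≤s (≤-trans (m∸n≤m B (suc k)) (m≤m+n B B)))))
  where
  i-[i+j]≡-j : ∀ i j → i -ℤ (i +ℤ j) ≡ -ℤ j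
  i-[i+j]≡-j = ℤ-Solver.solve-∀
  j : ℕ
  j = B ∸ suc k
  shift : + j -ℤ + B ≡ -[1+ k ]
  shift = begin
    + j -ℤ + B                ≡⟨ cong (λ b → + j -ℤ + b) (m∸n+n≡m k<B) ⟨
    + j -ℤ + (j + suc k)      ≡⟨ cong (λ b → + j -ℤ b) (ℤ.pos-+ j (suc k)) ⟩
    + j -ℤ (+ j +ℤ + suc k)   ≡⟨ i-[i+j]≡-j (+ j) (+ suc k) ⟩
    -[1+ k ]                  ∎

form-terms-≤ : (f : ℤ → ℕ) → ∀ {as xs} → All NonZero as → length xs ≡ length as →
  All (λ x → f x ≤ form f as xs) xs
form-terms-≤ f {[]}     {[]}     All.[]           _   = All.[]
form-terms-≤ f {a ∷ as} {x ∷ xs} (a≢0 All.∷ as≢0) len =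
  ≤-trans (m≤n*m (f x) a {{a≢0}}) (m≤m+n _ _) All.∷
  All.map (λ fy≤ → ≤-trans fy≤ (m≤n+m _ _)) (form-terms-≤ f as≢0 (suc-injective len))
form-terms-≤ f {[]}     {_ ∷ _}  _ ()
form-terms-≤ f {_ ∷ _}  {[]}     _ ()

solution∈tuples : (f : ℤ → ℕ) (B : ℕ) → ∀ {as xs n} → (∀ x → f x ≤ n → ∣ x ∣ ≤ B) →
  All NonZero as → length xs ≡ length as → form f as xs ≡ n → xs ∈ tuples (length as) (box B)
solution∈tuples f B {xs = xs} bound as≢0 len refl = subst (λ k → xs ∈ tuples k (box B)) len
  (∈-tuples⁺ (All.map (λ {x} fx≤ → ∈-box⁺ x (bound x fx≤)) (form-terms-≤ f as≢0 len)))

+sq : ∀ x → + sq x ≡ x *ℤ x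
+sq (+ zero) = refl
+sq +[1+ _ ] = refl
+sq -[1+ _ ] = refl

∣x∣≤sq : ∀ x → ∣ x ∣ ≤ sq x
∣x∣≤sq x = subst (∣ x ∣ ≤_) (sym (ℤ.abs-* x x)) (n≤n*n ∣ x ∣)
  where
  n≤n*n : ∀ n → n ≤ n * n
  n≤n*n zero    = z≤n
  n≤n*n (suc n) = m≤m*n (suc n) (suc n)

+[sq+3sq] : ∀ p q → + (sq p + 3 * sq q) ≡ p *ℤ p +ℤ + 3 *ℤ (q *ℤ q)
+[sq+3sq] p q = trans (ℤ.pos-+ (sq p) (3 * sq q))
  (cong₂ _+ℤ_ (+sq p) (trans (ℤ.pos-* 3 (sq q)) (cong ((+ 3) *ℤ_) (+sq q))))

triangular : ℕ → ℕ
triangular zero    = zero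
triangular (suc k) = suc k + triangular k

2*triangular : ∀ k → 2 * triangular k ≡ k * suc k
2*triangular zero    = refl
2*triangular (suc k) = begin
  2 * (suc k + triangular k)   ≡⟨ *-distribˡ-+ 2 (suc k) (triangular k) ⟩
  2 * suc k + 2 * triangular k ≡⟨ cong (_+_ (2 * suc k)) (2*triangular k) ⟩
  2 * suc k + k * suc k        ≡⟨ ℕ-Solver.solve (k ∷ []) ⟩
  suc k * suc (suc k)          ∎

n≤triangular : ∀ k → k ≤ triangular k
n≤triangular zero    = z≤n
n≤triangular (suc k) = m≤m+n (suc k) (triangular k)

-- tri x is the triangular number T (x - 1) for x > 0 and T (- x) for x ≤ 0.
tri-index : ℤ → ℕ
tri-index (+ zero) = zero
tri-index +[1+ k ] = k
tri-index -[1+ k ] = suc k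

x[x-1]≡2T : ∀ x → x *ℤ (x -ℤ + 1) ≡ + (2 * triangular (tri-index x))
x[x-1]≡2T (+ zero) = refl
x[x-1]≡2T +[1+ k ] = begin
  (+ 1 +ℤ + k) *ℤ ((+ 1 +ℤ + k) -ℤ + 1) ≡⟨ shift (+ k) ⟩
  + k *ℤ + suc k                        ≡⟨ ℤ.pos-* k (suc k) ⟨
  + (k * suc k)                         ≡⟨ cong +_ (2*triangular k) ⟨
  + (2 * triangular k)                  ∎
  where
  shift : ∀ K → (+ 1 +ℤ K) *ℤ ((+ 1 +ℤ K) -ℤ + 1) ≡ K *ℤ (+ 1 +ℤ K)
  shift = ℤ-Solver.solve-∀
x[x-1]≡2T -[1+ k ] = begin
  -ℤ (+ 1 +ℤ + k) *ℤ (-ℤ (+ 1 +ℤ + k) -ℤ + 1) ≡⟨ shift (+ k) ⟩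
  + suc k *ℤ + suc (suc k)                       ≡⟨ ℤ.pos-* (suc k) (suc (suc k)) ⟨
  + (suc k * suc (suc k))                        ≡⟨ cong +_ (2*triangular (suc k)) ⟨
  + (2 * triangular (suc k))                     ∎
  where
  shift : ∀ K → -ℤ (+ 1 +ℤ K) *ℤ (-ℤ (+ 1 +ℤ K) -ℤ + 1) ≡ (+ 1 +ℤ K) *ℤ (+ 1 +ℤ (+ 1 +ℤ K))
  shift = ℤ-Solver.solve-∀

tri≡triangular : ∀ x → tri x ≡ triangular (tri-index x)
tri≡triangular x = begin
  ∣ x *ℤ (x -ℤ + 1) ∣ / 2 ≡⟨ cong (λ y → ∣ y ∣ / 2) (x[x-1]≡2T x) ⟩
  2 * T / 2               ≡⟨ cong (_/ 2) (*-comm 2 T) ⟩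
  T * 2 / 2               ≡⟨ m*n/n≡m T 2 ⟩
  T                       ∎
  where
  T : ℕ
  T = triangular (tri-index x)

+[2*tri] : ∀ x → + (2 * tri x) ≡ x *ℤ (x -ℤ + 1)
+[2*tri] x = trans (cong (λ T → + (2 * T)) (tri≡triangular x)) (sym (x[x-1]≡2T x))

∣x∣≤1+tri : ∀ x → ∣ x ∣ ≤ 1 + tri x
∣x∣≤1+tri x = subst (λ T → ∣ x ∣ ≤ 1 + T) (sym (tri≡triangular x)) (bound x)
  where
  bound : ∀ x → ∣ x ∣ ≤ 1 + triangular (tri-index x)
  bound (+ zero) = z≤n
  bound +[1+ k ] = s≤s (n≤triangular k)
  bound -[1+ k ] = m≤n⇒m≤1+n (n≤triangular (suc k))

tri-reflect : ∀ x → tri (+ 1 -ℤ x) ≡ tri x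
tri-reflect x = *-cancelˡ-≡ _ _ 2 (ℤ.+-injective (begin
  + (2 * tri (+ 1 -ℤ x))            ≡⟨ +[2*tri] (+ 1 -ℤ x) ⟩
  (+ 1 -ℤ x) *ℤ ((+ 1 -ℤ x) -ℤ + 1) ≡⟨ ℤ-Solver.solve (x ∷ []) ⟩
  x *ℤ (x -ℤ + 1)                   ≡⟨ +[2*tri] x ⟨
  + (2 * tri x)                     ∎))

odd : ℤ → ℤ
odd k = + 2 *ℤ k -ℤ + 1

Odd : ℤ → Set
Odd x = ∃[ k ] x ≡ odd k

odd-square : ∀ k → sq (odd k) ≡ 8 * tri k + 1
odd-square k = ℤ.+-injective (begin
  + sq (odd k)                            ≡⟨ +sq (odd k) ⟩
  (+ 2 *ℤ k -ℤ + 1) *ℤ (+ 2 *ℤ k -ℤ + 1) ≡⟨ ℤ-Solver.solve (k ∷ []) ⟩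
  + 4 *ℤ (k *ℤ (k -ℤ + 1)) +ℤ + 1        ≡⟨ cong (λ y → + 4 *ℤ y +ℤ + 1) (+[2*tri] k) ⟨
  + 4 *ℤ + (2 * tri k) +ℤ + 1            ≡⟨ cong (_+ℤ + 1) (ℤ.pos-* 4 (2 * tri k)) ⟨
  + (4 * (2 * tri k)) +ℤ + 1             ≡⟨ ℤ.pos-+ (4 * (2 * tri k)) 1 ⟨
  + (4 * (2 * tri k) + 1)                ≡⟨ cong (λ T → + (T + 1)) (*-assoc 4 2 (tri k)) ⟨
  + (8 * tri k + 1)                      ∎)

odd-injective : ∀ {k j} → odd k ≡ odd j → k ≡ j
odd-injective {k} {j} eq = ℤ.*-cancelˡ-≡ (+ 2) k j (∙-cancelʳ (-ℤ + 1) _ _ eq)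

even⊎odd : ∀ x → + 2 ∣ x ⊎ Odd x
even⊎odd x with x %ℕ 2 | a≡a%ℕn+[a/ℕn]*n x 2 | n%ℕd<d x 2
... | 0           | x≡q*2   | _ = inj₁ (divides (x /ℕ 2) (trans x≡q*2 (ℤ.+-identityˡ _)))
... | 1           | x≡1+q*2 | _ = inj₂ (x /ℕ 2 +ℤ + 1 , trans x≡1+q*2 (shift (x /ℕ 2)))
  where
  shift : ∀ q → + 1 +ℤ q *ℤ + 2 ≡ + 2 *ℤ (q +ℤ + 1) -ℤ + 1
  shift = ℤ-Solver.solve-∀
... | suc (suc _) | _       | s≤s (s≤s ())

¬even⇒odd : ∀ {x} → ¬ + 2 ∣ x → Odd x
¬even⇒odd {x} ¬2∣x with even⊎odd x
... | inj₁ 2∣x   = ⊥-elim (¬2∣x 2∣x)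
... | inj₂ odd-x = odd-x

2∤1 : ¬ + 2 ∣ + 1
2∤1 2∣1 = 0≢1+n (sym (suc-injective (∣1⇒≡1 (∣⇒∣ᵤ 2∣1))))

2∤odd : ∀ k → ¬ + 2 ∣ odd k
2∤odd k 2∣odd =
  2∤1 (subst (+ 2 ∣_) (2k-[2k-1]≡1 k) (∣m∣n⇒∣m-n (divides k (ℤ.*-comm (+ 2) k)) 2∣odd))
  where
  2k-[2k-1]≡1 : ∀ k → + 2 *ℤ k -ℤ (+ 2 *ℤ k -ℤ + 1) ≡ + 1
  2k-[2k-1]≡1 = ℤ-Solver.solve-∀

even+odd-not-even : ∀ {g} k → + 2 ∣ g → ¬ + 2 ∣ g +ℤ odd k
even+odd-not-even k 2∣g 2∣g+odd = 2∤odd k (∣m+n∣m⇒∣n 2∣g+odd 2∣g)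

odd+odd-even : ∀ {g} k → Odd g → + 2 ∣ g +ℤ odd k
odd+odd-even k (j , refl) = divides (j +ℤ k -ℤ + 1) (sum-of-odds j k)
  where
  sum-of-odds : ∀ j k → (+ 2 *ℤ j -ℤ + 1) +ℤ (+ 2 *ℤ k -ℤ + 1) ≡ (j +ℤ k -ℤ + 1) *ℤ + 2
  sum-of-odds = ℤ-Solver.solve-∀

sq-double : ∀ q → sq (q *ℤ + 2) ≡ sq q * 4
sq-double q = ℤ.+-injective (begin
  + sq (q *ℤ + 2)           ≡⟨ +sq (q *ℤ + 2) ⟩
  q *ℤ + 2 *ℤ (q *ℤ + 2)    ≡⟨ ℤ-Solver.solve (q ∷ []) ⟩
  q *ℤ q *ℤ + 4             ≡⟨ cong (_*ℤ + 4) (+sq q) ⟨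
  + sq q *ℤ + 4             ≡⟨ ℤ.pos-* (sq q) 4 ⟨
  + (sq q * 4)              ∎)

sq%4 : ∀ x → (+ 2 ∣ x × sq x % 4 ≡ 0) ⊎ (Odd x × sq x % 4 ≡ 1)
sq%4 x with even⊎odd x
... | inj₁ (divides q refl) =
  inj₁ (divides q refl , trans (cong (_% 4) (sq-double q)) (m*n%n≡0 (sq q) 4))
... | inj₂ (k , refl) =
  inj₂ ((k , refl) , trans (cong (_% 4) (trans (odd-square k) (8T+1≡1+2T*4 (tri k))))
                           ([m+kn]%n≡m%n 1 (2 * tri k) 4))
  where
  8T+1≡1+2T*4 : ∀ T → 8 * T + 1 ≡ 1 + 2 * T * 4
  8T+1≡1+2T*4 = ℕ-Solver.solve-∀

sq%4≤1 : ∀ x → sq x % 4 ≤ 1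
sq%4≤1 x with sq%4 x
... | inj₁ (_ , r≡0) = subst (_≤ 1) (sym r≡0) z≤n
... | inj₂ (_ , r≡1) = subst (_≤ 1) (sym r≡1) (s≤s z≤n)

sq%4≡1⇒odd : ∀ x → sq x % 4 ≡ 1 → Odd x
sq%4≡1⇒odd x r≡1 with sq%4 x
... | inj₁ (_ , r≡0)     = ⊥-elim (0≢1+n (trans (sym r≡0) r≡1))
... | inj₂ (odd-x , _)   = odd-x

even-difference⇒4∣sq+3sq : ∀ u v → + 2 ∣ u -ℤ v → 4 ℕᵈ.∣ sq u + 3 * sq v
even-difference⇒4∣sq+3sq u v (divides q u-v≡q*2) =
  ∣⇒∣ᵤ (divides (v *ℤ v +ℤ v *ℤ q +ℤ q *ℤ q) (begin
    + (sq u + 3 * sq v)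
      ≡⟨ +[sq+3sq] u v ⟩
    u *ℤ u +ℤ + 3 *ℤ (v *ℤ v)
      ≡⟨ cong (λ y → y *ℤ y +ℤ + 3 *ℤ (v *ℤ v)) (i-j≡k⇒i≡k+j u v u-v≡q*2) ⟩
    (q *ℤ + 2 +ℤ v) *ℤ (q *ℤ + 2 +ℤ v) +ℤ + 3 *ℤ (v *ℤ v)
      ≡⟨ ℤ-Solver.solve (q ∷ v ∷ []) ⟩
    (v *ℤ v +ℤ v *ℤ q +ℤ q *ℤ q) *ℤ + 4
      ∎))

m+kn≡o+ln⇒m%n≡o%n : ∀ {m o} k l n .{{_ : NonZero n}} → m + k * n ≡ o + l * n → m % n ≡ o % n
m+kn≡o+ln⇒m%n≡o%n {m} {o} k l n eq =
  trans (sym ([m+kn]%n≡m%n m k n)) (trans (cong (_% n) eq) ([m+kn]%n≡m%n o l n))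

odd-product : ∀ a c → (a * c) % 2 ≡ 1 → a % 2 ≡ 1 × c % 2 ≡ 1
odd-product a c ac%2≡1 = residues (m%n<n a 2) (m%n<n c 2) (trans (sym (%-distribˡ-* a c 2)) ac%2≡1)
  where
  residues : ∀ {r s} → r < 2 → s < 2 → (r * s) % 2 ≡ 1 → r ≡ 1 × s ≡ 1
  residues {1}           {1}           _                _                _  = refl , refl
  residues {0}           {_}           _                _                ()
  residues {1}           {0}           _                _                ()
  residues {suc (suc _)} {_}           (s≤s (s≤s ()))   _                _
  residues {1}           {suc (suc _)} _                (s≤s (s≤s ()))   _

odd⇒%4 : ∀ c → c % 2 ≡ 1 → c % 4 ≡ 1 ⊎ c % 4 ≡ 3
odd⇒%4 c c%2≡1 = residues (m%n<n c 4) (trans (m∣n⇒o%n%m≡o%m 2 4 c (ℕᵈ.divides 2 refl)) c%2≡1)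
  where
  residues : ∀ {r} → r < 4 → r % 2 ≡ 1 → r ≡ 1 ⊎ r ≡ 3
  residues {1} _ _ = inj₁ refl
  residues {3} _ _ = inj₂ refl
  residues {0} _ ()
  residues {2} _ ()
  residues {suc (suc (suc (suc _)))} (s≤s (s≤s (s≤s (s≤s ())))) _

%-distrib-linear : ∀ m n p q d .{{_ : NonZero d}} →
  (m * n + p * q) % d ≡ ((m % d) * (n % d) + (p % d) * (q % d)) % d
%-distrib-linear m n p q d = begin
  (m * n + p * q) % d
    ≡⟨ %-distribˡ-+ (m * n) (p * q) d ⟩
  ((m * n) % d + (p * q) % d) % d
    ≡⟨ cong₂ (λ s t → (s + t) % d) (%-distribˡ-* m n d) (%-distribˡ-* p q d) ⟩
  ((m % d) * (n % d) % d + (p % d) * (q % d) % d) % d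
    ≡⟨ %-distribˡ-+ ((m % d) * (n % d)) ((p % d) * (q % d)) d ⟨
  ((m % d) * (n % d) + (p % d) * (q % d)) % d
    ∎

residue-check : ∀ {cr dr zr wr} → cr ≡ 1 ⊎ cr ≡ 3 → dr ≡ 2 ⊎ dr ≡ cr → zr ≤ 1 → wr ≤ 1 →
  (cr * zr + dr * wr) % 4 ≡ (cr + dr) % 4 → zr ≡ 1 × wr ≡ 1
residue-check _           _           (s≤s z≤n) (s≤s z≤n) _  = refl , refl
residue-check (inj₁ refl) (inj₁ refl) z≤n       z≤n       ()
residue-check (inj₁ refl) (inj₁ refl) z≤n       (s≤s z≤n) ()
residue-check (inj₁ refl) (inj₁ refl) (s≤s z≤n) z≤n       ()
residue-check (inj₁ refl) (inj₂ refl) z≤n       z≤n       ()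
residue-check (inj₁ refl) (inj₂ refl) z≤n       (s≤s z≤n) ()
residue-check (inj₁ refl) (inj₂ refl) (s≤s z≤n) z≤n       ()
residue-check (inj₂ refl) (inj₁ refl) z≤n       z≤n       ()
residue-check (inj₂ refl) (inj₁ refl) z≤n       (s≤s z≤n) ()
residue-check (inj₂ refl) (inj₁ refl) (s≤s z≤n) z≤n       ()
residue-check (inj₂ refl) (inj₂ refl) z≤n       z≤n       ()
residue-check (inj₂ refl) (inj₂ refl) z≤n       (s≤s z≤n) ()
residue-check (inj₂ refl) (inj₂ refl) (s≤s z≤n) z≤n       ()

squares-odd-mod-4 : ∀ c d Z W → c % 2 ≡ 1 → d % 4 ≡ 2 ⊎ d % 4 ≡ c % 4 →
  Z % 4 ≤ 1 → W % 4 ≤ 1 → (c * Z + d * W) % 4 ≡ (c + d) % 4 → Z % 4 ≡ 1 × W % 4 ≡ 1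
squares-odd-mod-4 c d Z W c%2≡1 d-cond Z≤1 W≤1 eq =
  residue-check (odd⇒%4 c c%2≡1) d-cond Z≤1 W≤1 (begin
  ((c % 4) * (Z % 4) + (d % 4) * (W % 4)) % 4 ≡⟨ %-distrib-linear c Z d W 4 ⟨
  (c * Z + d * W) % 4                         ≡⟨ eq ⟩
  (c + d) % 4                                 ≡⟨ %-distribˡ-+ c d 4 ⟩
  (c % 4 + d % 4) % 4                         ∎)

-- Mod 8 the left-hand side is c + d, while the right-hand side is c + d + 4.
mod-8-obstruction : ∀ {a} h c d n U V K L → a ≡ 1 + h * 2 → 4 ℕᵈ.∣ U + 3 * V →
  4 * a * U + (12 * a * V + (c * (8 * K + 1) + (d * (8 * L + 1) + 0))) ≢ 8 * n + 4 * a + c + d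
mod-8-obstruction {a} h c d n U V K L a≡1+2h (ℕᵈ.divides M U+3V≡M*4) eq =
  0≢4 (m+kn≡o+ln⇒m%n≡o%n (2 * a * M + c * K + d * L) (n + h) 8 (+-cancelˡ-≡ (c + d) _ _ (begin
    c + d + (0 + (2 * a * M + c * K + d * L) * 8)
      ≡⟨ ℕ-Solver.solve (a ∷ M ∷ c ∷ d ∷ K ∷ L ∷ []) ⟩
    4 * a * (M * 4) + (c * (8 * K + 1) + (d * (8 * L + 1) + 0))
      ≡⟨ cong (λ t → 4 * a * t + (c * (8 * K + 1) + (d * (8 * L + 1) + 0))) U+3V≡M*4 ⟨
    4 * a * (U + 3 * V) + (c * (8 * K + 1) + (d * (8 * L + 1) + 0))
      ≡⟨ ℕ-Solver.solve (a ∷ U ∷ V ∷ c ∷ d ∷ K ∷ L ∷ []) ⟩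
    4 * a * U + (12 * a * V + (c * (8 * K + 1) + (d * (8 * L + 1) + 0)))
      ≡⟨ eq ⟩
    8 * n + 4 * a + c + d
      ≡⟨ cong (λ a → 8 * n + 4 * a + c + d) a≡1+2h ⟩
    8 * n + 4 * (1 + h * 2) + c + d
      ≡⟨ ℕ-Solver.solve (n ∷ h ∷ c ∷ d ∷ []) ⟩
    c + d + (4 + (n + h) * 8)
      ∎)))
  where
  0≢4 : 0 % 8 ≢ 4 % 8
  0≢4 ()

-- The correspondence

gap : List ℤ → ℤ
gap (x₁ ∷ x₂ ∷ _) = x₁ -ℤ x₂
gap _             = + 0

reflect : List ℤ → List ℤ
reflect (x₁ ∷ x₂ ∷ xs) = x₁ ∷ + 1 -ℤ x₂ ∷ xs
reflect xs             = xs

reflect-involutive : ∀ xs → reflect (reflect xs) ≡ xs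
reflect-involutive []             = refl
reflect-involutive (_ ∷ [])       = refl
reflect-involutive (x₁ ∷ x₂ ∷ xs) = cong (λ y → x₁ ∷ y ∷ xs) (ℤ-Solver.solve (x₂ ∷ []))

reflect-injective : ∀ {xs ys} → reflect xs ≡ reflect ys → xs ≡ ys
reflect-injective {xs} {ys} eq =
  trans (sym (reflect-involutive xs)) (trans (cong reflect eq) (reflect-involutive ys))

i-[1-j]≡i-j+[2j-1] : ∀ i j → i -ℤ (+ 1 -ℤ j) ≡ i -ℤ j +ℤ (+ 2 *ℤ j -ℤ + 1)
i-[1-j]≡i-j+[2j-1] = ℤ-Solver.solve-∀

¬2∣i-j⇒2∣i-[1-j] : ∀ i j → ¬ + 2 ∣ i -ℤ j → + 2 ∣ i -ℤ (+ 1 -ℤ j)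
¬2∣i-j⇒2∣i-[1-j] i j odd-gap =
  subst (+ 2 ∣_) (sym (i-[1-j]≡i-j+[2j-1] i j)) (odd+odd-even j (¬even⇒odd odd-gap))

2∣i-j⇒¬2∣i-[1-j] : ∀ i j → + 2 ∣ i -ℤ j → ¬ + 2 ∣ i -ℤ (+ 1 -ℤ j)
2∣i-j⇒¬2∣i-[1-j] i j even-gap even-gap′ =
  even+odd-not-even j even-gap (subst (+ 2 ∣_) (i-[1-j]≡i-j+[2j-1] i j) even-gap′)

data Corresponds : List ℤ → List ℤ → Set where
  corresponds : ∀ {x₁ x₂ x₃ x₄ u v z w} →
    x₁ -ℤ x₂ ≡ v *ℤ + 2 → u -ℤ v ≡ odd x₂ → z ≡ odd x₃ → w ≡ odd x₄ →
    Corresponds (x₁ ∷ x₂ ∷ x₃ ∷ x₄ ∷ []) (u ∷ v ∷ z ∷ w ∷ [])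

Corresponds⇒even-gap : ∀ {x y} → Corresponds x y → + 2 ∣ gap x
Corresponds⇒even-gap (corresponds {v = v} gap≡ _ _ _) = divides v gap≡

Corresponds-injective : ∀ {x x′ y} → Corresponds x y → Corresponds x′ y → x ≡ x′
Corresponds-injective (corresponds {x₁} {x₂} {x₃} {x₄} gap≡ diff refl refl)
                      (corresponds {x₁′} {x₂′} {x₃′} {x₄′} gap≡′ diff′ z≡ w≡)
  with refl ← odd-injective {x₂} {x₂′} (trans (sym diff) diff′)
     | refl ← odd-injective {x₃} {x₃′} z≡
     | refl ← odd-injective {x₄} {x₄′} w≡ =
  cong (_∷ _) (∙-cancelʳ (-ℤ x₂) x₁ x₁′ (trans gap≡ (sym gap≡′)))

Corresponds-functional : ∀ {x y y′} → Corresponds x y → Corresponds x y′ → y ≡ y′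
Corresponds-functional (corresponds {v = v} gap≡ diff refl refl)
                       (corresponds {v = v′} gap≡′ diff′ refl refl)
  with refl ← ℤ.*-cancelʳ-≡ v v′ (+ 2) (trans (sym gap≡) gap≡′) =
  cong (_∷ _) (∙-cancelʳ (-ℤ v) _ _ (trans diff (sym diff′)))

x²+3y²-identity : ∀ x₁ x₂ u v → x₁ -ℤ x₂ ≡ v *ℤ + 2 → u -ℤ v ≡ odd x₂ →
  sq (odd x₁) + 3 * sq (odd x₂) ≡ 4 * (sq u + 3 * sq v)
x²+3y²-identity x₁ x₂ u v gap≡ diff = ℤ.+-injective (begin
  + (sq (odd x₁) + 3 * sq s)
    ≡⟨ +[sq+3sq] (odd x₁) s ⟩
  odd x₁ *ℤ odd x₁ +ℤ + 3 *ℤ (s *ℤ s)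
    ≡⟨ cong (λ y → y *ℤ y +ℤ + 3 *ℤ (s *ℤ s)) odd-x₁ ⟩
  (s +ℤ + 4 *ℤ v) *ℤ (s +ℤ + 4 *ℤ v) +ℤ + 3 *ℤ (s *ℤ s)
    ≡⟨ identity s v ⟩
  + 4 *ℤ ((s +ℤ v) *ℤ (s +ℤ v) +ℤ + 3 *ℤ (v *ℤ v))
    ≡⟨ cong (λ y → + 4 *ℤ (y *ℤ y +ℤ + 3 *ℤ (v *ℤ v))) u≡s+v ⟨
  + 4 *ℤ (u *ℤ u +ℤ + 3 *ℤ (v *ℤ v))
    ≡⟨ cong ((+ 4) *ℤ_) (+[sq+3sq] u v) ⟨
  + 4 *ℤ + (sq u + 3 * sq v)
    ≡⟨ ℤ.pos-* 4 (sq u + 3 * sq v) ⟨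
  + (4 * (sq u + 3 * sq v))
    ∎)
  where
  s : ℤ
  s = odd x₂
  identity : ∀ s v → (s +ℤ + 4 *ℤ v) *ℤ (s +ℤ + 4 *ℤ v) +ℤ + 3 *ℤ (s *ℤ s)
                   ≡ + 4 *ℤ ((s +ℤ v) *ℤ (s +ℤ v) +ℤ + 3 *ℤ (v *ℤ v))
  identity = ℤ-Solver.solve-∀
  odd-shift : ∀ v x → + 2 *ℤ (v *ℤ + 2 +ℤ x) -ℤ + 1 ≡ (+ 2 *ℤ x -ℤ + 1) +ℤ + 4 *ℤ v
  odd-shift = ℤ-Solver.solve-∀
  odd-x₁ : odd x₁ ≡ s +ℤ + 4 *ℤ v
  odd-x₁ = trans (cong odd (i-j≡k⇒i≡k+j x₁ x₂ gap≡)) (odd-shift v x₂)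
  u≡s+v : u ≡ s +ℤ v
  u≡s+v = i-j≡k⇒i≡k+j u v diff

8*tri-form+sum≡sq-form : ∀ as xs → length xs ≡ length as →
  8 * form tri as xs + sum as ≡ form sq as (map odd xs)
8*tri-form+sum≡sq-form []       []       _   = refl
8*tri-form+sum≡sq-form (a ∷ as) (x ∷ xs) len = begin
  8 * (a * tri x + form tri as xs) + (a + sum as)
    ≡⟨ regroup a (tri x) (form tri as xs) (sum as) ⟩
  a * (8 * tri x + 1) + (8 * form tri as xs + sum as)
    ≡⟨ cong₂ (λ s r → a * s + r) (odd-square x) (sym (8*tri-form+sum≡sq-form as xs (suc-injective len))) ⟨
  a * sq (odd x) + form sq as (map odd xs)
    ∎
  where
  regroup : ∀ a T F S → 8 * (a * T + F) + (a + S) ≡ a * (8 * T + 1) + (8 * F + S)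
  regroup = ℕ-Solver.solve-∀
8*tri-form+sum≡sq-form []       (_ ∷ _)  ()
8*tri-form+sum≡sq-form (_ ∷ _)  []       ()

scale-x²+3y² : ∀ a {P Q U V} R → P + 3 * Q ≡ 4 * (U + 3 * V) →
  a * P + (3 * a * Q + R) ≡ 4 * a * U + (12 * a * V + R)
scale-x²+3y² a {P} {Q} {U} {V} R eq = begin
  a * P + (3 * a * Q + R)       ≡⟨ ℕ-Solver.solve (a ∷ P ∷ Q ∷ R ∷ []) ⟩
  a * (P + 3 * Q) + R           ≡⟨ cong (λ t → a * t + R) eq ⟩
  a * (4 * (U + 3 * V)) + R     ≡⟨ ℕ-Solver.solve (a ∷ U ∷ V ∷ R ∷ []) ⟩
  4 * a * U + (12 * a * V + R)  ∎

module Correspondence (a c d n : ℕ) (a≢0 : NonZero a) (c≢0 : NonZero c) (d≢0 : NonZero d)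
  (ac-odd : (a * c) % 2 ≡ 1) (d-cond : d % 4 ≡ 2 ⊎ d % 4 ≡ c % 4) where

  private instance
    a-nonZero : NonZero a
    a-nonZero = a≢0

  T S : List ℕ
  T = a ∷ 3 * a ∷ c ∷ d ∷ []
  S = 4 * a ∷ 12 * a ∷ c ∷ d ∷ []

  m : ℕ
  m = 8 * n + 4 * a + c + d

  XS YS : List (List ℤ)
  XS = tuples 4 (box (suc n))
  YS = tuples 4 (box m)

  T-solution? : Decidable (λ x → form tri T x ≡ n)
  T-solution? x = form tri T x ≟ n

  S-solution? : Decidable (λ y → form sq S y ≡ m)
  S-solution? y = form sq S y ≟ m

  even-gap? : Decidable (λ x → + 2 ∣ gap x)
  even-gap? x = + 2 ∣? gap x

  T-solution∈XS : ∀ {x} → Quad x → form tri T x ≡ n → x ∈ XS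
  T-solution∈XS (quad _ _ _ _) = solution∈tuples tri (suc n)
    (λ x tri≤n → ≤-trans (∣x∣≤1+tri x) (s≤s tri≤n))
    (a≢0 All.∷ m*n≢0 3 a All.∷ c≢0 All.∷ d≢0 All.∷ All.[]) refl

  S-solution∈YS : ∀ {y} → Quad y → form sq S y ≡ m → y ∈ YS
  S-solution∈YS (quad _ _ _ _) = solution∈tuples sq m
    (λ x sq≤m → ≤-trans (∣x∣≤sq x) sq≤m)
    (m*n≢0 4 a All.∷ m*n≢0 12 a All.∷ c≢0 All.∷ d≢0 All.∷ All.[]) refl

  XS-Quad : ∀ {x} → x ∈ XS → Quad x
  XS-Quad {x} x∈XS = length≡4⇒Quad x (∈-tuples⇒length 4 {ys = box (suc n)} x∈XS)

  YS-Quad : ∀ {y} → y ∈ YS → Quad y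
  YS-Quad {y} y∈YS = length≡4⇒Quad y (∈-tuples⇒length 4 {ys = box m} y∈YS)

  S-solution-mod-4 : ∀ u v z w → form sq S (u ∷ v ∷ z ∷ w ∷ []) ≡ m →
    (c * sq z + d * sq w) % 4 ≡ (c + d) % 4
  S-solution-mod-4 u v z w eq = m+kn≡o+ln⇒m%n≡o%n (a * sq u + 3 * a * sq v) (2 * n + a) 4 (begin
    c * sq z + d * sq w + (a * sq u + 3 * a * sq v) * 4 ≡⟨ regroup (sq u) (sq v) (sq z) (sq w) ⟩
    form sq S (u ∷ v ∷ z ∷ w ∷ [])                      ≡⟨ eq ⟩
    8 * n + 4 * a + c + d                               ≡⟨ ℕ-Solver.solve (n ∷ a ∷ c ∷ d ∷ []) ⟩
    c + d + (2 * n + a) * 4                             ∎)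
    where
    regroup : ∀ U V Z W →
      c * Z + d * W + (a * U + 3 * a * V) * 4 ≡ 4 * a * U + (12 * a * V + (c * Z + (d * W + 0)))
    regroup U V Z W = ℕ-Solver.solve (a ∷ c ∷ d ∷ U ∷ V ∷ Z ∷ W ∷ [])

  S-solution⇒¬2∣u-v : ∀ u v k l → form sq S (u ∷ v ∷ odd k ∷ odd l ∷ []) ≡ m → ¬ + 2 ∣ u -ℤ v
  S-solution⇒¬2∣u-v u v k l eq even-gap =
    mod-8-obstruction (a / 2) c d n (sq u) (sq v) (tri k) (tri l) a≡1+2h
      (even-difference⇒4∣sq+3sq u v even-gap) (begin
      4 * a * sq u + (12 * a * sq v + (c * (8 * tri k + 1) + (d * (8 * tri l + 1) + 0)))
        ≡⟨ cong₂ (λ Z W → 4 * a * sq u + (12 * a * sq v + (c * Z + (d * W + 0))))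
                 (odd-square k) (odd-square l) ⟨
      form sq S (u ∷ v ∷ odd k ∷ odd l ∷ [])
        ≡⟨ eq ⟩
      m ∎)
    where
    a≡1+2h : a ≡ 1 + a / 2 * 2
    a≡1+2h = trans (m≡m%n+[m/n]*n a 2) (cong (_+ a / 2 * 2) (proj₁ (odd-product a c ac-odd)))

  S-solution-parities : ∀ u v z w → form sq S (u ∷ v ∷ z ∷ w ∷ []) ≡ m → Odd z × Odd w × Odd (u -ℤ v)
  S-solution-parities u v z w eq = odd-z , odd-w , ¬even⇒odd (S-solution⇒¬2∣u-v u v k l eq′)
    where
    residues : sq z % 4 ≡ 1 × sq w % 4 ≡ 1
    residues = squares-odd-mod-4 c d (sq z) (sq w) (proj₂ (odd-product a c ac-odd)) d-cond
                                 (sq%4≤1 z) (sq%4≤1 w) (S-solution-mod-4 u v z w eq)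
    odd-z : Odd z
    odd-z = sq%4≡1⇒odd z (proj₁ residues)
    odd-w : Odd w
    odd-w = sq%4≡1⇒odd w (proj₂ residues)
    k l : ℤ
    k = proj₁ odd-z
    l = proj₁ odd-w
    eq′ : form sq S (u ∷ v ∷ odd k ∷ odd l ∷ []) ≡ m
    eq′ = subst₂ (λ z w → form sq S (u ∷ v ∷ z ∷ w ∷ []) ≡ m) (proj₂ odd-z) (proj₂ odd-w) eq

  8*tri-form+K≡sq-form : ∀ {x y} → Corresponds x y → 8 * form tri T x + 4 * a + c + d ≡ form sq S y
  8*tri-form+K≡sq-form (corresponds {x₁} {x₂} {x₃} {x₄} {u} {v} gap≡ diff refl refl) = begin
    8 * form tri T x + 4 * a + c + d
      ≡⟨ regroup (form tri T x) ⟩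
    8 * form tri T x + sum T
      ≡⟨ 8*tri-form+sum≡sq-form T x refl ⟩
    form sq T (map odd x)
      ≡⟨ scale-x²+3y² a (c * sq (odd x₃) + (d * sq (odd x₄) + 0)) (x²+3y²-identity x₁ x₂ u v gap≡ diff) ⟩
    form sq S (u ∷ v ∷ odd x₃ ∷ odd x₄ ∷ [])
      ∎
    where
    x : List ℤ
    x = x₁ ∷ x₂ ∷ x₃ ∷ x₄ ∷ []
    regroup : ∀ F → 8 * F + 4 * a + c + d ≡ 8 * F + (a + (3 * a + (c + (d + 0))))
    regroup F = ℕ-Solver.solve (F ∷ a ∷ c ∷ d ∷ [])

  T-solution⇒S-solution : ∀ {x y} → Corresponds x y → form tri T x ≡ n → form sq S y ≡ m
  T-solution⇒S-solution corr x-sol =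
    trans (sym (8*tri-form+K≡sq-form corr)) (cong (λ F → 8 * F + 4 * a + c + d) x-sol)

  S-solution⇒T-solution : ∀ {x y} → Corresponds x y → form sq S y ≡ m → form tri T x ≡ n
  S-solution⇒T-solution {x} corr y-sol = *-cancelˡ-≡ (form tri T x) n 8
    (+-cancelʳ-≡ (4 * a) _ _ (+-cancelʳ-≡ c _ _ (+-cancelʳ-≡ d _ _
      (trans (8*tri-form+K≡sq-form corr) y-sol))))

  T-form-reflect : ∀ {x} → Quad x → form tri T (reflect x) ≡ form tri T x
  T-form-reflect (quad x₁ x₂ x₃ x₄) =
    cong (λ t → a * tri x₁ + (3 * a * t + form tri (c ∷ d ∷ []) (x₃ ∷ x₄ ∷ []))) (tri-reflect x₂)

  image : ∀ {x} → Quad x → form tri T x ≡ n → + 2 ∣ gap x →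
    ∃[ y ] y ∈ YS × form sq S y ≡ m × Corresponds x y
  image (quad x₁ x₂ x₃ x₄) x-sol (divides v gap≡) = y , S-solution∈YS (quad _ _ _ _) y-sol , y-sol , corr
    where
    y : List ℤ
    y = odd x₂ +ℤ v ∷ v ∷ odd x₃ ∷ odd x₄ ∷ []
    corr : Corresponds (x₁ ∷ x₂ ∷ x₃ ∷ x₄ ∷ []) y
    corr = corresponds gap≡ (i+j-j≡i (odd x₂) v) refl refl
    y-sol : form sq S y ≡ m
    y-sol = T-solution⇒S-solution corr x-sol

  image-reflected : ∀ {x} → Quad x → form tri T x ≡ n → ¬ + 2 ∣ gap x →
    ∃[ y ] y ∈ YS × form sq S y ≡ m × Corresponds (reflect x) y
  image-reflected (quad x₁ x₂ x₃ x₄) x-sol odd-gap =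
    image (quad x₁ (+ 1 -ℤ x₂) x₃ x₄) (trans (T-form-reflect (quad x₁ x₂ x₃ x₄)) x-sol)
          (¬2∣i-j⇒2∣i-[1-j] x₁ x₂ odd-gap)

  preimage-of-parities : ∀ {u v z w} → form sq S (u ∷ v ∷ z ∷ w ∷ []) ≡ m →
    Odd z → Odd w → Odd (u -ℤ v) → ∃[ x ] Quad x × form tri T x ≡ n × Corresponds x (u ∷ v ∷ z ∷ w ∷ [])
  preimage-of-parities {u} {v} {z} {w} y-sol (x₃ , z≡) (x₄ , w≡) (x₂ , diff) =
    x , quad _ _ _ _ , S-solution⇒T-solution corr y-sol , corr
    where
    x : List ℤ
    x = v *ℤ + 2 +ℤ x₂ ∷ x₂ ∷ x₃ ∷ x₄ ∷ []
    corr : Corresponds x (u ∷ v ∷ z ∷ w ∷ [])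
    corr = corresponds (i+j-j≡i (v *ℤ + 2) x₂) diff z≡ w≡

  preimage : ∀ {y} → Quad y → form sq S y ≡ m → ∃[ x ] Quad x × form tri T x ≡ n × Corresponds x y
  preimage (quad u v z w) y-sol =
    let odd-z , odd-w , odd-u-v = S-solution-parities u v z w y-sol
    in preimage-of-parities y-sol odd-z odd-w odd-u-v

  XS! : Unique XS
  XS! = tuples-unique 4 (box-unique (suc n))

  YS! : Unique YS
  YS! = tuples-unique 4 (box-unique m)

  count-even-gap : length (filter (T-solution? ∩? even-gap?) XS) ≡ N S m
  count-even-gap = length-filter-≡ (T-solution? ∩? even-gap?) S-solution? Corresponds XS! YS! forth back
    Corresponds-injective Corresponds-functional
    where
    forth : ∀ {x} → x ∈ XS → form tri T x ≡ n × + 2 ∣ gap x →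
      ∃[ y ] y ∈ YS × form sq S y ≡ m × Corresponds x y
    forth x∈XS (x-sol , even-gap) = image (XS-Quad x∈XS) x-sol even-gap
    in-XS : ∀ {y} → ∃[ x ] Quad x × form tri T x ≡ n × Corresponds x y →
      ∃[ x ] x ∈ XS × (form tri T x ≡ n × + 2 ∣ gap x) × Corresponds x y
    in-XS (x , x-quad , x-sol , corr) =
      x , T-solution∈XS x-quad x-sol , (x-sol , Corresponds⇒even-gap corr) , corr
    back : ∀ {y} → y ∈ YS → form sq S y ≡ m →
      ∃[ x ] x ∈ XS × (form tri T x ≡ n × + 2 ∣ gap x) × Corresponds x y
    back y∈YS y-sol = in-XS (preimage (YS-Quad y∈YS) y-sol)

  count-odd-gap : length (filter (T-solution? ∩? ∁? even-gap?) XS) ≡ N S m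
  count-odd-gap =
    length-filter-≡ (T-solution? ∩? ∁? even-gap?) S-solution? (λ x y → Corresponds (reflect x) y) XS! YS! forth back (λ p q → reflect-injective (Corresponds-injective p q)) Corresponds-functional
    where
    forth : ∀ {x} → x ∈ XS → form tri T x ≡ n × ¬ + 2 ∣ gap x →
      ∃[ y ] y ∈ YS × form sq S y ≡ m × Corresponds (reflect x) y
    forth x∈XS (x-sol , odd-gap) = image-reflected (XS-Quad x∈XS) x-sol odd-gap
    reflected-in-XS : ∀ {y} → ∃[ x ] Quad x × form tri T x ≡ n × Corresponds x y →
      ∃[ x ] x ∈ XS × (form tri T x ≡ n × ¬ + 2 ∣ gap x) × Corresponds (reflect x) y
    reflected-in-XS {y} (_ , quad x₁ x₂ x₃ x₄ , x-sol , corr) =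
      reflect x , T-solution∈XS (quad x₁ (+ 1 -ℤ x₂) x₃ x₄) x-sol′ ,
      (x-sol′ , 2∣i-j⇒¬2∣i-[1-j] x₁ x₂ (Corresponds⇒even-gap corr)) ,
      subst (λ x → Corresponds x y) (sym (reflect-involutive x)) corr
      where
      x : List ℤ
      x = x₁ ∷ x₂ ∷ x₃ ∷ x₄ ∷ []
      x-sol′ : form tri T (reflect x) ≡ n
      x-sol′ = trans (T-form-reflect (quad x₁ x₂ x₃ x₄)) x-sol
    back : ∀ {y} → y ∈ YS → form sq S y ≡ m →
      ∃[ x ] x ∈ XS × (form tri T x ≡ n × ¬ + 2 ∣ gap x) × Corresponds (reflect x) y
    back y∈YS y-sol = reflected-in-XS (preimage (YS-Quad y∈YS) y-sol)

corollary5p2 : (a c d n : ℕ) → NonZero a → NonZero c → NonZero d → NonZero n →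
    (a * c) % 2 ≡ 1 → (d % 4 ≡ 2 ⊎ d % 4 ≡ c % 4) →
    t (a ∷ 3 * a ∷ c ∷ d ∷ []) n ≡ 2 * N (4 * a ∷ 12 * a ∷ c ∷ d ∷ []) (8 * n + 4 * a + c + d)
corollary5p2 a c d n a≢0 c≢0 d≢0 _ ac-odd d-cond = begin
  t T n
    ≡⟨ length-filter-split T-solution? even-gap? XS ⟩
  length (filter (T-solution? ∩? even-gap?) XS) + length (filter (T-solution? ∩? ∁? even-gap?) XS)
    ≡⟨ cong₂ _+_ count-even-gap count-odd-gap ⟩
  N S m + N S m
    ≡⟨ cong (_+_ (N S m)) (+-identityʳ (N S m)) ⟨
  2 * N S m
    ∎
  where open Correspondence a c d n a≢0 c≢0 d≢0 ac-odd d-cond
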